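{- Let $q=3^r\ge 27$ and let $g_0\in\mathcal{T}_q$ be the function given, for $a$ coprime to $q$ with representative in $\{1,\dots,q-1\}$, by $g_0(a)=0$ if $a<q/3$; $g_0(a)=0$ if $q/3<a<2q/3$ and $a\equiv 1\pmod 3$; $g_0(a)=1$ if $q/3<a<2q/3$ and $a\equiv 2\pmod 3$; $g_0(a)=1$ if $a>2q/3$. Let $h(a)=\lfloor 3a/q\rfloor$ and suppose $h=g_1+g_2$ with $g_1,g_2\in\mathcal{T}_q$. Then $g_2=g_1\circ\theta_s$ for some $s\in(\mathbb{Z}/q\mathbb{Z})^\times$ if and only if the pair $(s,g_1)$ equals $(q/3-1,g_0)$ or $(2q/3-1,g_0\circ\theta_{q/3-1})$. In particular, if $g_0\notin\{g_1,g_2\}$, then $g_2\ne g_1\circ\theta_s$ for every $s\in(\mathbb{Z}/q\mathbb{Z})^\times$.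
   Context: $\mathcal{T}_q$ is the set of functions $g:(\mathbb{Z}/q\mathbb{Z})^\times\to\{0,1\}$ such that $g(a)+g(-a)=1$ for all $a$, and $g(a)=0$ for every $a$ whose representative in $\{1,\dots,q-1\}$ is less than $q/3$. For $s\in(\mathbb{Z}/q\mathbb{Z})^\times$, $\theta_s$ denotes multiplication by $s$. $h(a)$ uses the representative of $a$ in $\{1,\dots,q-1\}$. -}

module Defs where

open import Data.Nat using (ℕ; zero; suc; _+_; _*_; _∸_; _^_; _<_; _≤_; _<?_; _≟_; NonZero)
open import Data.Nat.Properties using (m^n≢0)
open import Data.Nat.DivMod using (_/_; _%_)
open import Data.Nat.Coprimality using (Coprime)
open import Data.Bool using (Bool; true; false; if_then_else_)
open import Data.Product using (_×_)
open import Relation.Binary.PropositionalEquality using (_≡_)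
open import Relation.Nullary.Decidable using (⌊_⌋)

Q : ℕ → ℕ
Q r = 3 ^ r

Q-nonZero : ∀ r → NonZero (Q r)
Q-nonZero r = m^n≢0 3 r

-- Elements of (ℤ/qℤ)^× are represented by their representatives a ∈ {0,…,q-1}
-- with gcd(a,q) = 1 (this automatically excludes a = 0).
IsUnit : ℕ → ℕ → Set
IsUnit q a = (a < q) × Coprime a q

b2n : Bool → ℕ
b2n false = 0
b2n true  = 1

-- Functions (ℤ/qℤ)^× → {0,1}, given on representatives.
Fun : Set
Fun = ℕ → Bool

_≐[_]_ : Fun → ℕ → Fun → Set
g ≐[ q ] g' = ∀ a → IsUnit q a → g a ≡ g' a

_∘θ[_]_ : Fun → ℕ → ℕ → Fun
(g ∘θ[ r ] s) a = g (_%_ (s * a) (Q r) {{Q-nonZero r}})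

-- Membership in 𝒯_q: g(a) + g(-a) = 1, and g(a) = 0 whenever a < q/3.
-- (-a is represented by q - a for a unit a ∈ {1,…,q-1}.)
InT : ℕ → Fun → Set
InT r g =
  (∀ a → IsUnit (Q r) a → b2n (g a) + b2n (g (Q r ∸ a)) ≡ 1) ×
  (∀ a → IsUnit (Q r) a → 3 * a < Q r → g a ≡ false)

h : ℕ → ℕ → ℕ
h r a = _/_ (3 * a) (Q r) {{Q-nonZero r}}

g₀ : ℕ → Fun
g₀ r a =
  if ⌊ 3 * a <? Q r ⌋ then false
  else if ⌊ 3 * a <? 2 * Q r ⌋ then ⌊ a % 3 ≟ 2 ⌋
  else true

{-# OPTIONS --safe #-}
module Submission where

-- Write q = 3m. A function in 𝒯_q is 0 on the lower third of the units and 1 on the upper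
-- third, so in a splitting h = g₁ + g₂ the two are complementary on the middle third and each
-- determines the other. If g₂ = g₁ ∘ θ_s, then θ_s maps no unit of the lower third into the
-- upper third. For s > 2m the unit 1 violates this; for 3 ≤ s < m/2 so does the first unit a
-- with s a > 2m, and for m/2 < s < m - 1 some a ≡ 1 (mod 3) with m < a (m - s) < 2m; s = 1, 2
-- fail on explicit middle units. So a multiplier below m is m - 1. As (m - 1) a ≡ (a mod 3) m - a
-- (mod q), θ_{m-1} sends the middle units ≡ 1 to the upper third and those ≡ 2 to the lower one;
-- this forces g₁ = g₀ and shows that (g₀, g₀ ∘ θ_{m-1}) splits h. A multiplier in the middle
-- third forces g₁(m + 1) = 1; since g₁ = g₂ ∘ θ_{s⁻¹}, the inverse cannot lie there too, so
-- s⁻¹ = m - 1, g₂ = g₀, and s = 2m - 1 because (m - 1)(2m - 1) ≡ 1 (mod q).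

open import Defs
open import Data.Bool using (true; false; not)
open import Data.Bool.Properties using (not-¬)
open import Data.Empty using (⊥; ⊥-elim)
open import Data.Nat
open import Data.Nat.Properties
open import Data.Nat.DivMod
open import Data.Nat.Divisibility
open import Data.Nat.Coprimality using (Coprime; coprime-Bézout; coprime-divisor)
open import Data.Nat.GCD using (module Bézout)
open import Data.Nat.Primality using (prime?; euclidsLemma; prime⇒irreducible)
open import Data.Nat.Tactic.RingSolver using (solve-∀)
open import Data.Product
open import Data.Sum
open import Function.Base using (_∘_)
open import Function.Bundles using (_⇔_; mk⇔)
open import Relation.Binary.Definitions using (tri<; tri≈; tri>)
open import Relation.Binary.PropositionalEquality
open import Relation.Nullary
open import Relation.Nullary.Decidable using (⌊_⌋; from-yes)

m≡o+kn⇒m%n≡o : ∀ {m o} k n .{{_ : NonZero n}} → m ≡ o + k * n → o < n → m % n ≡ o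
m≡o+kn⇒m%n≡o {o = o} k n refl o<n = trans ([m+kn]%n≡m%n o k n) (m<n⇒m%n≡m o<n)

m≡o+kn⇒m/n≡k : ∀ {m o} k n .{{_ : NonZero n}} → m ≡ o + k * n → o < n → m / n ≡ k
m≡o+kn⇒m/n≡k {o = o} k n refl o<n = begin
  (o + k * n) / n     ≡⟨ +-distrib-/-∣ʳ o (n∣m*n k) ⟩
  o / n + k * n / n   ≡⟨ cong₂ _+_ (m<n⇒m/n≡0 o<n) (m*n/n≡m k n) ⟩
  k                   ∎
  where open ≡-Reasoning

m*[n%d]%d≡m*n%d : ∀ m n d .{{_ : NonZero d}} → (m * (n % d)) % d ≡ (m * n) % d
m*[n%d]%d≡m*n%d m n d = begin
  (m * (n % d)) % d          ≡⟨ %-distribˡ-* m (n % d) d ⟩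
  (m % d * (n % d % d)) % d  ≡⟨ cong (λ x → (m % d * x) % d) (m%n%n≡m%n n d) ⟩
  (m % d * (n % d)) % d      ≡⟨ %-distribˡ-* m n d ⟨
  (m * n) % d                ∎
  where open ≡-Reasoning

[m%d]*n%d≡m*n%d : ∀ m n d .{{_ : NonZero d}} → (m % d * n) % d ≡ (m * n) % d
[m%d]*n%d≡m*n%d m n d = begin
  (m % d * n) % d    ≡⟨ cong (_% d) (*-comm (m % d) n) ⟩
  (n * (m % d)) % d  ≡⟨ m*[n%d]%d≡m*n%d n m d ⟩
  (n * m) % d        ≡⟨ cong (_% d) (*-comm n m) ⟩
  (m * n) % d        ∎
  where open ≡-Reasoning

a*[b*c%n]%n≡[a*b%n]*c%n : ∀ a b c n .{{_ : NonZero n}} →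
  (a * ((b * c) % n)) % n ≡ ((a * b) % n * c) % n
a*[b*c%n]%n≡[a*b%n]*c%n a b c n = begin
  (a * ((b * c) % n)) % n  ≡⟨ m*[n%d]%d≡m*n%d a (b * c) n ⟩
  (a * (b * c)) % n        ≡⟨ cong (_% n) (*-assoc a b c) ⟨
  (a * b * c) % n          ≡⟨ [m%d]*n%d≡m*n%d (a * b) c n ⟨
  ((a * b) % n * c) % n    ∎
  where open ≡-Reasoning

x+a≡c+kn⇒x%n+a≡c : ∀ {x a c} k n .{{_ : NonZero n}} →
  x + a ≡ c + k * n → a ≤ c → c < a + n → x % n + a ≡ c
x+a≡c+kn⇒x%n+a≡c {x} {a} {c} k n eq a≤c c<a+n = begin
  x % n + a  ≡⟨ cong (_+ a) (m≡o+kn⇒m%n≡o k n x≡ (+-cancelʳ-< a (c ∸ a) n c∸a+a<n+a)) ⟩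
  c ∸ a + a  ≡⟨ m∸n+n≡m a≤c ⟩
  c          ∎
  where
  open ≡-Reasoning
  c∸a+a<n+a : c ∸ a + a < n + a
  c∸a+a<n+a = subst₂ _<_ (sym (m∸n+n≡m a≤c)) (+-comm a n) c<a+n
  x≡ : x ≡ c ∸ a + k * n
  x≡ = +-cancelʳ-≡ a x (c ∸ a + k * n) (begin
    x + a                ≡⟨ eq ⟩
    c + k * n            ≡⟨ cong (_+ k * n) (m∸n+n≡m a≤c) ⟨
    c ∸ a + a + k * n    ≡⟨ +-assoc (c ∸ a) a (k * n) ⟩
    c ∸ a + (a + k * n)  ≡⟨ cong (c ∸ a +_) (+-comm a (k * n)) ⟩
    c ∸ a + (k * n + a)  ≡⟨ +-assoc (c ∸ a) (k * n) a ⟨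
    c ∸ a + k * n + a    ∎)

x+a≡c+kn⇒x%n+a≡c+n : ∀ {x a c} k n .{{_ : NonZero n}} →
  x + a ≡ c + k * n → c < a → a ≤ c + n → x % n + a ≡ c + n
x+a≡c+kn⇒x%n+a≡c+n {x} {a} {c} zero n eq c<a _ =
  ⊥-elim (<-irrefl (trans (sym (+-identityʳ c)) (sym eq)) (<-≤-trans c<a (m≤n+m a x)))
x+a≡c+kn⇒x%n+a≡c+n {c = c} (suc k) n eq c<a a≤c+n =
  x+a≡c+kn⇒x%n+a≡c k n (trans eq (sym (+-assoc c n (k * n)))) a≤c+n (+-monoˡ-< n c<a)

least-multiple-above : ∀ B d .{{_ : NonZero d}} → B < suc (B / d) * d × suc (B / d) * d ≤ d + B
least-multiple-above B d =
  subst (_< d + B / d * d) (sym (m≡m%n+[m/n]*n B d)) (+-monoˡ-< (B / d * d) (m%n<n B d)) ,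
  +-monoʳ-≤ d (m/n*n≤m B d)

m+n≡o+p∧p<n⇒m<o : ∀ {m n o p} → m + n ≡ o + p → p < n → m < o
m+n≡o+p∧p<n⇒m<o {m} {o = o} eq p<n with m <? o
... | yes m<o = m<o
... | no m≮o = ⊥-elim (<-irrefl (sym eq) (+-mono-≤-< (≮⇒≥ m≮o) p<n))

m+n≡o+p∧n<p⇒o<m : ∀ {m n o p} → m + n ≡ o + p → n < p → o < m
m+n≡o+p∧n<p⇒o<m eq n<p = m+n≡o+p∧p<n⇒m<o (sym eq) n<p

2*n≡n+n : ∀ n → 2 * n ≡ n + n
2*n≡n+n n = cong (n +_) (+-identityʳ n)

-- Residues modulo 3

3∤1 : 3 ∤ 1
3∤1 = >⇒∤ (s≤s (s≤s z≤n))

3∤1+k*3 : ∀ k → 3 ∤ 1 + k * 3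
3∤1+k*3 k 3∣ = 0≢1+n (trans (sym (n∣m⇒m%n≡0 _ 3 3∣)) ([m+kn]%n≡m%n 1 k 3))

3∤2+k*3 : ∀ k → 3 ∤ 2 + k * 3
3∤2+k*3 k 3∣ = 0≢1+n (trans (sym (n∣m⇒m%n≡0 _ 3 3∣)) ([m+kn]%n≡m%n 2 k 3))

3∣n⇒3∤1+n : ∀ {n} → 3 ∣ n → 3 ∤ suc n
3∣n⇒3∤1+n (divides k refl) = 3∤1+k*3 k

3∣n⇒3∤2+n : ∀ {n} → 3 ∣ n → 3 ∤ 2 + n
3∣n⇒3∤2+n (divides k refl) = 3∤2+k*3 k

3∣n⇒3∤n∸1 : ∀ {n} → 0 < n → 3 ∣ n → 3 ∤ n ∸ 1
3∣n⇒3∤n∸1 {suc n} _ 3∣1+n 3∣n = 3∣n⇒3∤1+n 3∣n 3∣1+n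

3∤n⊎3∤1+n : ∀ n → 3 ∤ n ⊎ 3 ∤ suc n
3∤n⊎3∤1+n n with 3 ∣? n
... | no 3∤n = inj₁ 3∤n
... | yes 3∣n = inj₂ (3∣n⇒3∤1+n 3∣n)

3∤*3∤⇒3∤* : ∀ {a b} → 3 ∤ a → 3 ∤ b → 3 ∤ a * b
3∤*3∤⇒3∤* {a} {b} 3∤a 3∤b 3∣ab = [ 3∤a , 3∤b ]′ (euclidsLemma a b (from-yes (prime? 3)) 3∣ab)

3∤n⇒n≢1⇒n≢2⇒3≤n : ∀ {n} → 3 ∤ n → n ≢ 1 → n ≢ 2 → 3 ≤ n
3∤n⇒n≢1⇒n≢2⇒3≤n {0} 3∤0 _ _ = ⊥-elim (3∤0 (3 ∣0))
3∤n⇒n≢1⇒n≢2⇒3≤n {1} _ n≢1 _ = ⊥-elim (n≢1 refl)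
3∤n⇒n≢1⇒n≢2⇒3≤n {2} _ _ n≢2 = ⊥-elim (n≢2 refl)
3∤n⇒n≢1⇒n≢2⇒3≤n {suc (suc (suc _))} _ _ _ = s≤s (s≤s (s≤s z≤n))

data Residue₃ : ℕ → Set where
  1+3* : ∀ j → Residue₃ (1 + j * 3)
  2+3* : ∀ j → Residue₃ (2 + j * 3)

residue₃ : ∀ {a} → 3 ∤ a → Residue₃ a
residue₃ {a} 3∤a = subst Residue₃ (sym (m≡m%n+[m/n]*n a 3))
  (view (a % 3) (m%n<n a 3) (3∤a ∘ m%n≡0⇒n∣m a 3))
  where
  view : ∀ e → e < 3 → e ≢ 0 → Residue₃ (e + a / 3 * 3)
  view 0 _ e≢0 = ⊥-elim (e≢0 refl)
  view 1 _ _ = 1+3* (a / 3)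
  view 2 _ _ = 2+3* (a / 3)
  view (suc (suc (suc _))) (s≤s (s≤s (s≤s ()))) _

y%3+a%3≡3 : ∀ {y a} → 3 ∤ a → 3 ∣ y + a → y % 3 + a % 3 ≡ 3
y%3+a%3≡3 {y} {a} 3∤a (divides c eq) =
  sum (y % 3) (a % 3) (m%n<n y 3) (m%n<n a 3) (3∤a ∘ m%n≡0⇒n∣m a 3) [y%3+a%3]%3≡0
  where
  [y%3+a%3]%3≡0 : (y % 3 + a % 3) % 3 ≡ 0
  [y%3+a%3]%3≡0 = trans (sym (%-distribˡ-+ y a 3)) (trans (cong (_% 3) eq) (m*n%n≡0 c 3))
  sum : ∀ u v → u < 3 → v < 3 → v ≢ 0 → (u + v) % 3 ≡ 0 → u + v ≡ 3
  sum _ 0 _ _ v≢0 _ = ⊥-elim (v≢0 refl)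
  sum 0 1 _ _ _ ()
  sum 0 2 _ _ _ ()
  sum 1 1 _ _ _ ()
  sum 1 2 _ _ _ _ = refl
  sum 2 1 _ _ _ _ = refl
  sum 2 2 _ _ _ ()
  sum (suc (suc (suc _))) _ (s≤s (s≤s (s≤s ()))) _ _ _
  sum _ (suc (suc (suc _))) _ (s≤s (s≤s (s≤s ()))) _ _

3∣y+[1+3j]⇒y%3≡2 : ∀ {y} j → 3 ∣ y + (1 + j * 3) → y % 3 ≡ 2
3∣y+[1+3j]⇒y%3≡2 {y} j 3∣ = +-cancelʳ-≡ 1 (y % 3) 2
  (trans (cong (y % 3 +_) (sym ([m+kn]%n≡m%n 1 j 3))) (y%3+a%3≡3 (3∤1+k*3 j) 3∣))

3∣y+[2+3j]⇒y%3≡1 : ∀ {y} j → 3 ∣ y + (2 + j * 3) → y % 3 ≡ 1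
3∣y+[2+3j]⇒y%3≡1 {y} j 3∣ = +-cancelʳ-≡ 2 (y % 3) 1
  (trans (cong (y % 3 +_) (sym ([m+kn]%n≡m%n 2 j 3))) (y%3+a%3≡3 (3∤2+k*3 j) 3∣))

3∤-multiple-above : ∀ B d .{{_ : NonZero d}} → ∃ λ a → 3 ∤ a × B < a * d × a * d ≤ d + (d + B)
3∤-multiple-above B d with least-multiple-above B d | 3∤n⊎3∤1+n (suc (B / d))
... | B<a₀d , a₀d≤d+B | inj₁ 3∤a₀ =
  suc (B / d) , 3∤a₀ , B<a₀d , ≤-trans a₀d≤d+B (m≤n+m (d + B) d)
... | B<a₀d , a₀d≤d+B | inj₂ 3∤1+a₀ =
  suc (suc (B / d)) , 3∤1+a₀ , <-≤-trans B<a₀d (m≤n+m _ d) , +-monoʳ-≤ d a₀d≤d+B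

3∤⇒coprime-3 : ∀ {x} → 3 ∤ x → Coprime x 3
3∤⇒coprime-3 3∤x (d∣x , d∣3) with prime⇒irreducible (from-yes (prime? 3)) d∣3
... | inj₁ d≡1 = d≡1
... | inj₂ refl = ⊥-elim (3∤x d∣x)

coprime-* : ∀ {a b c} → Coprime a b → Coprime a c → Coprime a (b * c)
coprime-* cab cac (d∣a , d∣bc) =
  cac (d∣a , coprime-divisor (λ (e∣d , e∣b) → cab (∣-trans e∣d d∣a , e∣b)) d∣bc)

3∤⇒coprime-3^ : ∀ {x} n → 3 ∤ x → Coprime x (3 ^ n)
3∤⇒coprime-3^ zero _ (_ , d∣1) = ∣1⇒≡1 d∣1
3∤⇒coprime-3^ (suc n) 3∤x = coprime-* (3∤⇒coprime-3 3∤x) (3∤⇒coprime-3^ n 3∤x)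

coprime-3^⇒3∤ : ∀ {x} n → Coprime x (3 ^ suc n) → 3 ∤ x
coprime-3^⇒3∤ n cop 3∣x with cop (3∣x , m∣m*n (3 ^ n))
... | ()

modular-inverse : ∀ {s} n .{{_ : NonZero n}} → 1 < n → Coprime s n → ∃ λ s' → (s * s') % n ≡ 1
modular-inverse (suc zero) (s≤s ()) _
modular-inverse {s} (suc (suc p)) _ cop with coprime-Bézout cop
... | Bézout.+- x y eq = x , m≡o+kn⇒m%n≡o y (2 + p) (trans (*-comm s x) (sym eq)) (s≤s (s≤s z≤n))
... | Bézout.-+ x zero ()
... | Bézout.-+ x (suc y) eq =
  x * suc p , m≡o+kn⇒m%n≡o (p + y * suc p) (2 + p) s*[x*[1+p]]≡ (s≤s (s≤s z≤n))
  where
  open ≡-Reasoning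
  -- Here s x ≡ -1 and (n - 1)² ≡ 1 modulo n = 2 + p, so x (n - 1) inverts s.
  square : ∀ p y → (suc p + y * (2 + p)) * suc p ≡ 1 + (p + y * suc p) * (2 + p)
  square = solve-∀
  s*[x*[1+p]]≡ : s * (x * suc p) ≡ 1 + (p + y * suc p) * (2 + p)
  s*[x*[1+p]]≡ = begin
    s * (x * suc p)                ≡⟨ *-assoc s x (suc p) ⟨
    s * x * suc p                  ≡⟨ cong (_* suc p) (suc-injective (trans (cong suc (*-comm s x)) eq)) ⟩
    (suc p + y * (2 + p)) * suc p  ≡⟨ square p y ⟩
    1 + (p + y * suc p) * (2 + p)  ∎

inverse-cancel : ∀ {s s' a} n .{{_ : NonZero n}} →
  (s * s') % n ≡ 1 → a < n → (s * ((s' * a) % n)) % n ≡ a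
inverse-cancel {s} {s'} {a} n ss'≡1 a<n = begin
  (s * ((s' * a) % n)) % n  ≡⟨ a*[b*c%n]%n≡[a*b%n]*c%n s s' a n ⟩
  ((s * s') % n * a) % n    ≡⟨ cong (λ x → (x * a) % n) ss'≡1 ⟩
  (1 * a) % n               ≡⟨ cong (_% n) (*-identityˡ a) ⟩
  a % n                     ≡⟨ m<n⇒m%n≡m a<n ⟩
  a                         ∎
  where open ≡-Reasoning

inverse-unique : ∀ {s u v} n .{{_ : NonZero n}} →
  (s * u) % n ≡ 1 → (u * v) % n ≡ 1 → s < n → v < n → s ≡ v
inverse-unique {s} {u} {v} n su≡1 uv≡1 s<n v<n = begin
  s                        ≡⟨ m<n⇒m%n≡m s<n ⟨
  s % n                    ≡⟨ cong (_% n) (*-identityʳ s) ⟨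
  (s * 1) % n              ≡⟨ cong (λ x → (s * x) % n) uv≡1 ⟨
  (s * ((u * v) % n)) % n  ≡⟨ a*[b*c%n]%n≡[a*b%n]*c%n s u v n ⟩
  ((s * u) % n * v) % n    ≡⟨ cong (λ x → (x * v) % n) su≡1 ⟩
  (1 * v) % n              ≡⟨ cong (_% n) (*-identityˡ v) ⟩
  v % n                    ≡⟨ m<n⇒m%n≡m v<n ⟩
  v                        ∎
  where open ≡-Reasoning

[3N-1]*[6N-1]≡1+[2N-1]*9N : ∀ {N} → 0 < N →
  (3 * N ∸ 1) * (2 * (3 * N) ∸ 1) ≡ 1 + (2 * N ∸ 1) * (3 * (3 * N))
[3N-1]*[6N-1]≡1+[2N-1]*9N {suc n} _ = begin
  (3 * suc n ∸ 1) * (2 * (3 * suc n) ∸ 1)  ≡⟨ cong₂ (λ x y → (x ∸ 1) * (y ∸ 1)) (E₁ n) (E₂ n) ⟩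
  (2 + 3 * n) * (5 + 6 * n)                ≡⟨ E₃ n ⟩
  1 + (1 + 2 * n) * (3 * (3 * suc n))      ≡⟨ cong (λ x → 1 + (x ∸ 1) * (3 * (3 * suc n))) (E₄ n) ⟨
  1 + (2 * suc n ∸ 1) * (3 * (3 * suc n))  ∎
  where
  open ≡-Reasoning
  E₁ : ∀ n → 3 * suc n ≡ 3 + 3 * n
  E₁ = solve-∀
  E₂ : ∀ n → 2 * (3 * suc n) ≡ 6 + 6 * n
  E₂ = solve-∀
  E₃ : ∀ n → (2 + 3 * n) * (5 + 6 * n) ≡ 1 + (1 + 2 * n) * (3 * (3 * suc n))
  E₃ = solve-∀
  E₄ : ∀ n → 2 * suc n ≡ 2 + 2 * n
  E₄ = solve-∀

false≢true : false ≢ true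
false≢true ()

b2n-sum≡1 : ∀ x y → b2n x + b2n y ≡ 1 → x ≡ not y
b2n-sum≡1 false true _ = refl
b2n-sum≡1 true false _ = refl
b2n-sum≡1 false false ()
b2n-sum≡1 true true ()

b2n-injective : ∀ {x y} → b2n x ≡ b2n y → x ≡ y
b2n-injective {false} {false} _ = refl
b2n-injective {true} {true} _ = refl
b2n-injective {false} {true} ()
b2n-injective {true} {false} ()

module Modulus (k : ℕ) where

  r m q : ℕ
  r = 3 + k
  m = 3 ^ (2 + k)
  q = Q r

  instance
    q≢0 : NonZero q
    q≢0 = Q-nonZero r
    m≢0 : NonZero m
    m≢0 = m^n≢0 3 (2 + k)

  q/3≡m : q / 3 ≡ m
  q/3≡m = trans (cong (_/ 3) (*-comm 3 m)) (m*n/n≡m m 3)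

  3∣m : 3 ∣ m
  3∣m = m∣m*n (3 ^ (1 + k))

  3∣2m : 3 ∣ 2 * m
  3∣2m = ∣-trans 3∣m (n∣m*n 2)

  3∣q : 3 ∣ q
  3∣q = m∣m*n m

  3∣m+q : 3 ∣ m + q
  3∣m+q = ∣m∣n⇒∣m+n 3∣m 3∣q

  m+q≡2m+2m : m + q ≡ 2 * m + 2 * m
  m+q≡2m+2m = regroup m
    where
    regroup : ∀ m → m + 3 * m ≡ 2 * m + 2 * m
    regroup = solve-∀

  3*2m≡2q : 3 * (2 * m) ≡ 2 * q
  3*2m≡2q = commute m
    where
    commute : ∀ m → 3 * (2 * m) ≡ 2 * (3 * m)
    commute = solve-∀

  9≤m : 9 ≤ m
  9≤m = *-monoʳ-≤ 3 (*-monoʳ-≤ 3 (m^n>0 3 k))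

  0<m : 0 < m
  0<m = ≤-trans (s≤s z≤n) 9≤m

  1<m : 1 < m
  1<m = ≤-trans (s≤s (s≤s z≤n)) 9≤m

  2<m : 2 < m
  2<m = ≤-trans (s≤s (s≤s (s≤s z≤n))) 9≤m

  4<m : 4 < m
  4<m = ≤-trans (s≤s (s≤s (s≤s (s≤s (s≤s z≤n))))) 9≤m

  m<q : m < q
  m<q = m<m+n m (<-≤-trans 0<m (m≤m+n m (m + 0)))

  2m<q : 2 * m < q
  2m<q = *-monoˡ-< m {2} {3} ≤-refl

  1<q : 1 < q
  1<q = <-trans 1<m m<q

  c<m⇒c+m<2m : ∀ {c} → c < m → c + m < 2 * m
  c<m⇒c+m<2m {c} c<m = subst (c + m <_) (sym (2*n≡n+n m)) (+-monoˡ-< m c<m)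

  c<m⇒c+2m<q : ∀ {c} → c < m → c + 2 * m < q
  c<m⇒c+2m<q = +-monoˡ-< (2 * m)

  Unit : ℕ → Set
  Unit a = a < q × 3 ∤ a

  Unit⇒IsUnit : ∀ {a} → Unit a → IsUnit q a
  Unit⇒IsUnit (a<q , 3∤a) = a<q , 3∤⇒coprime-3^ r 3∤a

  IsUnit⇒Unit : ∀ {a} → IsUnit q a → Unit a
  IsUnit⇒Unit (a<q , cop) = a<q , coprime-3^⇒3∤ (2 + k) cop

  unit-1 : Unit 1
  unit-1 = 1<q , 3∤1

  unit-1+m : Unit (1 + m)
  unit-1+m = <-trans (c<m⇒c+m<2m 1<m) 2m<q , 3∣n⇒3∤1+n 3∣m

  unit-2+m : Unit (2 + m)
  unit-2+m = <-trans (c<m⇒c+m<2m 2<m) 2m<q , 3∣n⇒3∤2+n 3∣m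

  unit-1+2m : Unit (1 + 2 * m)
  unit-1+2m = c<m⇒c+2m<q 1<m , 3∣n⇒3∤1+n 3∣2m

  unit-4+2m : Unit (4 + 2 * m)
  unit-4+2m = c<m⇒c+2m<q 4<m , 3∣n⇒3∤1+n (∣m∣n⇒∣m+n (∣-refl {3}) 3∣2m)

  unit-m-1 : Unit (m ∸ 1)
  unit-m-1 = ≤-<-trans (m∸n≤m m 1) m<q , 3∣n⇒3∤n∸1 0<m 3∣m

  unit-2m-1 : Unit (2 * m ∸ 1)
  unit-2m-1 = ≤-<-trans (m∸n≤m (2 * m) 1) 2m<q , 3∣n⇒3∤n∸1 (<-≤-trans 0<m (m≤n*m m 2)) 3∣2m

  θ : ℕ → ℕ → ℕ
  θ s a = (s * a) % q

  θ-Unit : ∀ {s a} → Unit s → Unit a → Unit (θ s a)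
  θ-Unit {s} {a} (_ , 3∤s) (_ , 3∤a) = m%n<n (s * a) q , 3∤*3∤⇒3∤* 3∤s 3∤a ∘ ∣n∣m%n⇒∣m 3∣q

  θ-small : ∀ s a → s * a < q → θ s a ≡ s * a
  θ-small _ _ = m<n⇒m%n≡m

  θ-identityˡ : ∀ {a} → a < q → θ 1 a ≡ a
  θ-identityˡ {a} a<q = trans (cong (_% q) (*-identityˡ a)) (m<n⇒m%n≡m a<q)

  θ-identityʳ : ∀ {s} → s < q → θ s 1 ≡ s
  θ-identityʳ {s} s<q = trans (cong (_% q) (*-identityʳ s)) (m<n⇒m%n≡m s<q)

  unit-inverse : ∀ {s} → Unit s → ∃ λ s' → Unit s' × (s * s') % q ≡ 1
  unit-inverse {s} us with modular-inverse q 1<q (proj₂ (Unit⇒IsUnit us))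
  ... | s' , ss'≡1 = s' % q , (m%n<n s' q , 3∤s'%q) , ss'%q≡1
    where
    ss'%q≡1 : (s * (s' % q)) % q ≡ 1
    ss'%q≡1 = trans (m*[n%d]%d≡m*n%d s s' q) ss'≡1
    3∤s'%q : 3 ∤ s' % q
    3∤s'%q 3∣ = 3∤1 (subst (3 ∣_) ss'%q≡1 (%-presˡ-∣ (∣-trans 3∣ (n∣m*n s)) 3∣q))

  -- Thirds, h and g₀

  data Region (a : ℕ) : Set where
    low  : a < m → Region a
    mid  : m < a → a < 2 * m → Region a
    high : 2 * m < a → Region a

  region : ∀ {a} → 3 ∤ a → Region a
  region {a} 3∤a with <-cmp a m
  ... | tri< a<m _ _ = low a<m
  ... | tri≈ _ refl _ = ⊥-elim (3∤a 3∣m)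
  ... | tri> _ _ m<a with <-cmp a (2 * m)
  ...   | tri< a<2m _ _ = mid m<a a<2m
  ...   | tri≈ _ refl _ = ⊥-elim (3∤a 3∣2m)
  ...   | tri> _ _ 2m<a = high 2m<a

  InT-low : ∀ {g a} → InT r g → Unit a → a < m → g a ≡ false
  InT-low (_ , vanish) ua a<m = vanish _ (Unit⇒IsUnit ua) (*-monoʳ-< 3 a<m)

  InT-high : ∀ {g a} → InT r g → Unit a → 2 * m < a → g a ≡ true
  InT-high {g} {a} T@(antisym , _) ua@(a<q , 3∤a) 2m<a =
    trans (b2n-sum≡1 (g a) (g (q ∸ a)) (antisym a (Unit⇒IsUnit ua))) (cong not (InT-low T u-a -a<m))
    where
    -a+a≡q : q ∸ a + a ≡ m + 2 * m
    -a+a≡q = m∸n+n≡m (<⇒≤ a<q)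
    -a<m : q ∸ a < m
    -a<m = m+n≡o+p∧p<n⇒m<o -a+a≡q 2m<a
    u-a : Unit (q ∸ a)
    u-a = <-≤-trans -a<m (m≤m+n m (2 * m)) ,
          λ 3∣-a → 3∤a (∣m+n∣m⇒∣n (subst (3 ∣_) (sym -a+a≡q) 3∣q) 3∣-a)

  h-digit : ∀ {a} o j → a ≡ o + j * m → o < m → h r a ≡ j
  h-digit {a} o j a≡ o<m = m≡o+kn⇒m/n≡k j q 3a≡ (*-monoʳ-< 3 o<m)
    where
    distrib : ∀ o j m → 3 * (o + j * m) ≡ 3 * o + j * (3 * m)
    distrib = solve-∀
    3a≡ : 3 * a ≡ 3 * o + j * q
    3a≡ = trans (cong (3 *_) a≡) (distrib o j m)

  h-low : ∀ {a} → a < m → h r a ≡ 0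
  h-low {a} a<m = h-digit a 0 (sym (+-identityʳ a)) a<m

  h-mid : ∀ {a} → m < a → a < 2 * m → h r a ≡ 1
  h-mid {a} m<a a<2m = h-digit (a ∸ m) 1 a≡ (m<n+o⇒m∸n<o a m (subst (a <_) (2*n≡n+n m) a<2m))
    where
    a≡ : a ≡ a ∸ m + 1 * m
    a≡ = trans (sym (m∸n+n≡m (<⇒≤ m<a))) (cong (a ∸ m +_) (sym (*-identityˡ m)))

  h-high : ∀ {a} → 2 * m < a → a < q → h r a ≡ 2
  h-high {a} 2m<a a<q =
    h-digit (a ∸ 2 * m) 2 (sym (m∸n+n≡m (<⇒≤ 2m<a)))
      (m<n+o⇒m∸n<o a (2 * m) (subst (a <_) (+-comm m (2 * m)) a<q))

  Splitting : Fun → Fun → Set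
  Splitting g₁ g₂ = ∀ a → IsUnit q a → h r a ≡ b2n (g₁ a) + b2n (g₂ a)

  splitting-sym : ∀ {g₁ g₂} → Splitting g₁ g₂ → Splitting g₂ g₁
  splitting-sym {g₁} {g₂} split a ua = trans (split a ua) (+-comm (b2n (g₁ a)) (b2n (g₂ a)))

  splitting-congˡ : ∀ {g₁ g₁' g₂} → g₁ ≐[ q ] g₁' → Splitting g₁ g₂ → Splitting g₁' g₂
  splitting-congˡ {g₂ = g₂} g₁≐g₁' split a ua =
    trans (split a ua) (cong (λ x → b2n x + b2n (g₂ a)) (g₁≐g₁' a ua))

  splitting-unique : ∀ {g g₁ g₂} → Splitting g g₁ → Splitting g g₂ → g₁ ≐[ q ] g₂
  splitting-unique {g} split₁ split₂ a ua =
    b2n-injective (+-cancelˡ-≡ (b2n (g a)) _ _ (trans (sym (split₁ a ua)) (split₂ a ua)))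

  splitting-mid : ∀ {g₁ g₂ a} → Splitting g₁ g₂ → Unit a → m < a → a < 2 * m → g₁ a ≡ not (g₂ a)
  splitting-mid {g₁} {g₂} {a} split ua m<a a<2m =
    b2n-sum≡1 (g₁ a) (g₂ a) (trans (sym (split a (Unit⇒IsUnit ua))) (h-mid m<a a<2m))

  g₀-low : ∀ {a} → a < m → g₀ r a ≡ false
  g₀-low {a} a<m with 3 * a <? q
  ... | yes _ = refl
  ... | no 3a≮q = ⊥-elim (3a≮q (*-monoʳ-< 3 a<m))

  g₀-mid : ∀ {a e} → m < a → a < 2 * m → a % 3 ≡ e → g₀ r a ≡ ⌊ e ≟ 2 ⌋
  g₀-mid {a} m<a a<2m refl with 3 * a <? q | 3 * a <? 2 * q
  ... | yes 3a<q | _ = ⊥-elim (<-asym 3a<q (*-monoʳ-< 3 m<a))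
  ... | no _ | yes _ = refl
  ... | no _ | no 3a≮2q = ⊥-elim (3a≮2q (subst (3 * a <_) 3*2m≡2q (*-monoʳ-< 3 a<2m)))

  g₀-high : ∀ {a} → 2 * m < a → g₀ r a ≡ true
  g₀-high {a} 2m<a with 3 * a <? q | 3 * a <? 2 * q
  ... | yes 3a<q | _ = ⊥-elim (<-asym 3a<q (*-monoʳ-< 3 (≤-<-trans (m≤n*m m 2) 2m<a)))
  ... | no _ | yes 3a<2q = ⊥-elim (<-asym 3a<2q (subst (_< 3 * a) 3*2m≡2q (*-monoʳ-< 3 2m<a)))
  ... | no _ | no _ = refl

  -- Multiplication by m - 1

  θpred : ℕ → ℕ
  θpred = θ (m ∸ 1)

  pred-m*a+a≡m*a : ∀ a → (m ∸ 1) * a + a ≡ m * a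
  pred-m*a+a≡m*a a = trans (+-comm ((m ∸ 1) * a) a) (cong (_* a) (m+[n∸m]≡n 0<m))

  pred-m*[1+3j] : ∀ j → (m ∸ 1) * (1 + j * 3) + (1 + j * 3) ≡ m + j * q
  pred-m*[1+3j] j = trans (pred-m*a+a≡m*a (1 + j * 3)) (distrib j m)
    where
    distrib : ∀ j m → m * (1 + j * 3) ≡ m + j * (3 * m)
    distrib = solve-∀

  pred-m*[2+3j] : ∀ j → (m ∸ 1) * (2 + j * 3) + (2 + j * 3) ≡ 2 * m + j * q
  pred-m*[2+3j] j = trans (pred-m*a+a≡m*a (2 + j * 3)) (distrib j m)
    where
    distrib : ∀ j m → m * (2 + j * 3) ≡ 2 * m + j * (3 * m)
    distrib = solve-∀

  θpred-low : ∀ {a} → Unit a → a < m →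
    θpred a < m ⊎ (m < θpred a × θpred a < 2 * m × θpred a % 3 ≡ 1)
  θpred-low (_ , 3∤a) a<m with residue₃ 3∤a
  ... | 1+3* j = inj₁ (m+n≡o+p∧p<n⇒m<o (trans y+a≡m (sym (+-identityʳ m))) (s≤s z≤n))
    where
    a = 1 + j * 3
    y+a≡m : θpred a + a ≡ m
    y+a≡m = x+a≡c+kn⇒x%n+a≡c j q (pred-m*[1+3j] j) (<⇒≤ a<m) (<-≤-trans m<q (m≤n+m q a))
  ... | 2+3* j = inj₂ (m+n≡o+p∧n<p⇒o<m (trans y+a≡2m (2*n≡n+n m)) a<m ,
                       m+n≡o+p∧p<n⇒m<o (trans y+a≡2m (sym (+-identityʳ (2 * m)))) (s≤s z≤n) ,
                       3∣y+[2+3j]⇒y%3≡1 j (subst (3 ∣_) (sym y+a≡2m) 3∣2m))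
    where
    a = 2 + j * 3
    y+a≡2m : θpred a + a ≡ 2 * m
    y+a≡2m = x+a≡c+kn⇒x%n+a≡c j q (pred-m*[2+3j] j) (≤-trans (<⇒≤ a<m) (m≤n*m m 2))
               (<-≤-trans 2m<q (m≤n+m q a))

  θpred-mid : ∀ {a} → Unit a → m < a → a < 2 * m →
    (a % 3 ≡ 1 × 2 * m < θpred a) ⊎ (a % 3 ≡ 2 × θpred a < m)
  θpred-mid (a<q , 3∤a) m<a a<2m with residue₃ 3∤a
  ... | 1+3* j = inj₁ ([m+kn]%n≡m%n 1 j 3 , m+n≡o+p∧n<p⇒o<m (trans y+a≡m+q m+q≡2m+2m) a<2m)
    where
    a = 1 + j * 3
    y+a≡m+q : θpred a + a ≡ m + q
    y+a≡m+q = x+a≡c+kn⇒x%n+a≡c+n j q (pred-m*[1+3j] j) m<a (≤-trans (<⇒≤ a<q) (m≤n+m q m))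
  ... | 2+3* j = inj₂ ([m+kn]%n≡m%n 2 j 3 , m+n≡o+p∧p<n⇒m<o (trans y+a≡2m (2*n≡n+n m)) m<a)
    where
    a = 2 + j * 3
    y+a≡2m : θpred a + a ≡ 2 * m
    y+a≡2m = x+a≡c+kn⇒x%n+a≡c j q (pred-m*[2+3j] j) (<⇒≤ a<2m) (<-≤-trans 2m<q (m≤n+m q a))

  θpred-high : ∀ {a} → Unit a → 2 * m < a →
    2 * m < θpred a ⊎ (m < θpred a × θpred a < 2 * m × θpred a % 3 ≡ 2)
  θpred-high (a<q , 3∤a) 2m<a with residue₃ 3∤a
  ... | 1+3* j = inj₂ (m+n≡o+p∧n<p⇒o<m y+a≡m+q a<q ,
                       m+n≡o+p∧p<n⇒m<o (trans y+a≡m+q m+q≡2m+2m) 2m<a ,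
                       3∣y+[1+3j]⇒y%3≡2 j (subst (3 ∣_) (sym y+a≡m+q) 3∣m+q))
    where
    a = 1 + j * 3
    y+a≡m+q : θpred a + a ≡ m + q
    y+a≡m+q = x+a≡c+kn⇒x%n+a≡c+n j q (pred-m*[1+3j] j) (≤-<-trans (m≤n*m m 2) 2m<a)
                (≤-trans (<⇒≤ a<q) (m≤n+m q m))
  ... | 2+3* j = inj₁ (m+n≡o+p∧n<p⇒o<m y+a≡2m+q a<q)
    where
    a = 2 + j * 3
    y+a≡2m+q : θpred a + a ≡ 2 * m + q
    y+a≡2m+q = x+a≡c+kn⇒x%n+a≡c+n j q (pred-m*[2+3j] j) 2m<a (≤-trans (<⇒≤ a<q) (m≤n+m q (2 * m)))

  θpred-inverse : ((m ∸ 1) * (2 * m ∸ 1)) % q ≡ 1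
  θpred-inverse =
    m≡o+kn⇒m%n≡o (2 * 3 ^ (1 + k) ∸ 1) q ([3N-1]*[6N-1]≡1+[2N-1]*9N (m^n>0 3 (1 + k))) 1<q

  splitting-g₀ : Splitting (g₀ r) (g₀ r ∘θ[ r ] (m ∸ 1))
  splitting-g₀ a ia = split (region (proj₂ ua))
    where
    ua = IsUnit⇒Unit ia
    sum≡ : ∀ {x y} → g₀ r a ≡ x → g₀ r (θpred a) ≡ y → h r a ≡ b2n x + b2n y →
           h r a ≡ b2n (g₀ r a) + b2n (g₀ r (θpred a))
    sum≡ refl refl h≡ = h≡
    split : Region a → h r a ≡ b2n (g₀ r a) + b2n (g₀ r (θpred a))
    split (low a<m) = sum≡ (g₀-low a<m)
      ([ g₀-low , (λ (m<y , y<2m , y≡1) → g₀-mid m<y y<2m y≡1) ]′ (θpred-low ua a<m)) (h-low a<m)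
    split (mid m<a a<2m) with θpred-mid ua m<a a<2m
    ... | inj₁ (a≡1 , 2m<y) = sum≡ (g₀-mid m<a a<2m a≡1) (g₀-high 2m<y) (h-mid m<a a<2m)
    ... | inj₂ (a≡2 , y<m) = sum≡ (g₀-mid m<a a<2m a≡2) (g₀-low y<m) (h-mid m<a a<2m)
    split (high 2m<a) = sum≡ (g₀-high 2m<a)
      ([ g₀-high , (λ (m<y , y<2m , y≡2) → g₀-mid m<y y<2m y≡2) ]′ (θpred-high ua 2m<a))
      (h-high 2m<a (proj₁ ua))

  partner-of-g₀ : ∀ {g₁ g₂} → Splitting g₁ g₂ → g₁ ≐[ q ] g₀ r → g₂ ≐[ q ] (g₀ r ∘θ[ r ] (m ∸ 1))
  partner-of-g₀ {g₁} split g₁≐g₀ =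
    splitting-unique {g₀ r} (splitting-congˡ {g₁} g₁≐g₀ split) splitting-g₀

  partner-of-g₀θ : ∀ {g₁ g₂} → Splitting g₁ g₂ → g₁ ≐[ q ] (g₀ r ∘θ[ r ] (m ∸ 1)) → g₂ ≐[ q ] g₀ r
  partner-of-g₀θ {g₁} split g₁≐ =
    splitting-unique {g₀ r ∘θ[ r ] (m ∸ 1)} (splitting-congˡ {g₁} g₁≐ split) (splitting-sym {g₀ r} splitting-g₀)

  -- Twists

  module Twisted {g₁ g₂ : Fun} (T₁ : InT r g₁) (T₂ : InT r g₂) (split : Splitting g₁ g₂)
                 {s : ℕ} (us : Unit s) (twist : g₂ ≐[ q ] (g₁ ∘θ[ r ] s)) where

    twist-at : ∀ {a} → Unit a → g₂ a ≡ g₁ (θ s a)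
    twist-at ua = twist _ (Unit⇒IsUnit ua)

    mid-complement : ∀ {a} → Unit a → m < a → a < 2 * m → g₁ a ≡ not (g₂ a)
    mid-complement = splitting-mid {g₁} {g₂} split

    low↛high : ∀ {a} → Unit a → a < m → ¬ 2 * m < θ s a
    low↛high ua a<m 2m<θ = false≢true
      (trans (sym (InT-low T₂ ua a<m)) (trans (twist-at ua) (InT-high T₁ (θ-Unit us ua) 2m<θ)))

    not-high : ¬ 2 * m < s
    not-high 2m<s = low↛high unit-1 1<m (subst (2 * m <_) (sym (θ-identityʳ (proj₁ us))) 2m<s)

    not-one : s ≢ 1
    not-one refl = not-¬ refl (trans (mid-complement unit-1+m (n<1+n m) (c<m⇒c+m<2m 1<m)) (cong not g₂≡g₁))
      where
      g₂≡g₁ : g₂ (1 + m) ≡ g₁ (1 + m)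
      g₂≡g₁ = trans (twist-at unit-1+m) (cong g₁ (θ-identityˡ (proj₁ unit-1+m)))

    not-two : s ≢ 2
    not-two refl = not-¬ refl (begin
      g₁ (2 + m)        ≡⟨ mid-complement unit-2+m (m<n+m m {2} (s≤s z≤n)) (c<m⇒c+m<2m 2<m) ⟩
      not (g₂ (2 + m))  ≡⟨ cong not g₂[2+m]≡true ⟩
      false             ≡⟨ cong not g₁[2+m]≡true ⟨
      not (g₁ (2 + m))  ∎)
      where
      open ≡-Reasoning
      twice : ∀ m → 2 * (1 + 2 * m) ≡ (2 + m) + 1 * (3 * m)
      twice = solve-∀
      twice' : ∀ m → 2 * (2 + m) ≡ 4 + 2 * m
      twice' = solve-∀
      g₁[2+m]≡true : g₁ (2 + m) ≡ true
      g₁[2+m]≡true = trans (cong g₁ (sym (m≡o+kn⇒m%n≡o 1 q (twice m) (proj₁ unit-2+m))))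
        (trans (sym (twist-at unit-1+2m)) (InT-high T₂ unit-1+2m (n<1+n (2 * m))))
      θ2[2+m]≡4+2m : θ 2 (2 + m) ≡ 4 + 2 * m
      θ2[2+m]≡4+2m = trans (θ-small 2 (2 + m) (subst (_< q) (sym (twice' m)) (proj₁ unit-4+2m))) (twice' m)
      g₂[2+m]≡true : g₂ (2 + m) ≡ true
      g₂[2+m]≡true = trans (twist-at unit-2+m)
        (trans (cong g₁ θ2[2+m]≡4+2m) (InT-high T₁ unit-4+2m (m<n+m (2 * m) {4} (s≤s z≤n))))

    not-small : 3 ≤ s → 2 * s < m → ⊥
    not-small 3≤s 2s<m with 3∤-multiple-above (2 * m) s {{>-nonZero (<-≤-trans (s≤s z≤n) 3≤s)}}
    ... | a , 3∤a , 2m<as , as≤s+[s+2m] =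
      low↛high (<-trans a<m m<q , 3∤a) a<m (subst (2 * m <_) (sym θ≡as) 2m<as)
      where
      as<q : a * s < q
      as<q = ≤-<-trans (≤-trans as≤s+[s+2m] (≤-reflexive (sym (+-assoc s s (2 * m)))))
               (c<m⇒c+2m<q (subst (_< m) (2*n≡n+n s) 2s<m))
      a<m : a < m
      a<m = ≰⇒> λ m≤a → <⇒≱ as<q (subst (_≤ a * s) (*-comm m 3) (*-mono-≤ m≤a 3≤s))
      θ≡as : θ s a ≡ a * s
      θ≡as = trans (θ-small s a (subst (_< q) (*-comm a s) as<q)) (*-comm s a)

    -- With s = m - t and a ≡ 1 (mod 3), s a ≡ 4m - a t (mod q).
    near-witness : ∀ {t} → s + t ≡ m → 2 ≤ t → ∀ j →
      m < (1 + j * 3) * t → (1 + j * 3) * t < 2 * m → ⊥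
    near-witness {t} s+t≡m 2≤t j m<at at<2m = low↛high (<-trans a<m m<q , 3∤1+k*3 j) a<m 2m<θ
      where
      a = 1 + j * 3
      expand : ∀ s t j → s * (1 + j * 3) + (1 + j * 3) * t ≡ (s + t) + j * (3 * (s + t))
      expand = solve-∀
      sa+at≡ : s * a + a * t ≡ m + j * q
      sa+at≡ = trans (expand s t j) (cong (λ x → x + j * (3 * x)) s+t≡m)
      at≤m+q : a * t ≤ m + q
      at≤m+q = ≤-trans (<⇒≤ at<2m) (subst (2 * m ≤_) (sym m+q≡2m+2m) (m≤m+n (2 * m) (2 * m)))
      2m<θ : 2 * m < θ s a
      2m<θ = m+n≡o+p∧n<p⇒o<m (trans (x+a≡c+kn⇒x%n+a≡c+n j q sa+at≡ m<at at≤m+q) m+q≡2m+2m) at<2m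
      a<m : a < m
      a<m = ≰⇒> λ m≤a → <⇒≱ at<2m (subst (_≤ a * t) (*-comm m 2) (*-mono-≤ m≤a 2≤t))

    not-near : ∀ {t} → s + t ≡ m → 2 ≤ t → 2 * t < m → ⊥
    not-near {t} s+t≡m 2≤t 2t<m with m <? 4 * t
    ... | yes m<4t =
      near-witness s+t≡m 2≤t 1 m<4t (subst (_< 2 * m) (sym (*-assoc 2 2 t)) (*-monoʳ-< 2 2t<m))
    ... | no m≮4t = near-witness s+t≡m 2≤t j m<at at<2m
      where
      instance
        t≢0 : NonZero t
        t≢0 = >-nonZero (<-≤-trans (s≤s z≤n) 2≤t)
        3t≢0 : NonZero (3 * t)
        3t≢0 = m*n≢0 3 t
      t≤m : t ≤ m
      t≤m = subst (t ≤_) s+t≡m (m≤n+m t s)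
      3t+m<2m : 3 * t + m < 2 * m
      3t+m<2m = c<m⇒c+m<2m (<-≤-trans (*-monoˡ-< t {3} {4} ≤-refl) (≮⇒≥ m≮4t))
      j = suc ((m ∸ t) / (3 * t))
      bounds = least-multiple-above (m ∸ t) (3 * t)
      expand : ∀ j t → (1 + j * 3) * t ≡ t + j * (3 * t)
      expand = solve-∀
      regroup : ∀ t x → t + (3 * t + x) ≡ 3 * t + (x + t)
      regroup = solve-∀
      m<at : m < (1 + j * 3) * t
      m<at = subst₂ _<_ (m∸n+n≡m t≤m) (trans (+-comm (j * (3 * t)) t) (sym (expand j t)))
               (+-monoˡ-< t (proj₁ bounds))
      at<2m : (1 + j * 3) * t < 2 * m
      at<2m = begin-strict
        (1 + j * 3) * t        ≡⟨ expand j t ⟩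
        t + j * (3 * t)        ≤⟨ +-monoʳ-≤ t (proj₂ bounds) ⟩
        t + (3 * t + (m ∸ t))  ≡⟨ regroup t (m ∸ t) ⟩
        3 * t + (m ∸ t + t)    ≡⟨ cong (3 * t +_) (m∸n+n≡m t≤m) ⟩
        3 * t + m              <⟨ 3t+m<2m ⟩
        2 * m                  ∎
        where open ≤-Reasoning

    low⇒pred-m : s < m → s ≡ m ∸ 1
    low⇒pred-m s<m with <-cmp (2 * s) m
    ... | tri< 2s<m _ _ = ⊥-elim (not-small (3∤n⇒n≢1⇒n≢2⇒3≤n (proj₂ us) not-one not-two) 2s<m)
    ... | tri≈ _ 2s≡m _ =
      ⊥-elim (3∤*3∤⇒3∤* (>⇒∤ (s≤s (s≤s (s≤s z≤n)))) (proj₂ us) (subst (3 ∣_) (sym 2s≡m) 3∣m))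
    ... | tri> _ _ m<2s = complement (m ∸ s) (m+[n∸m]≡n (<⇒≤ s<m))
      where
      complement : ∀ t → s + t ≡ m → s ≡ m ∸ 1
      complement 0 s+0≡m = ⊥-elim (<-irrefl (trans (sym (+-identityʳ s)) s+0≡m) s<m)
      complement 1 s+1≡m = sym (trans (cong (_∸ 1) (sym s+1≡m)) (m+n∸n≡m s 1))
      complement t@(suc (suc _)) s+t≡m = ⊥-elim (not-near s+t≡m (s≤s (s≤s z≤n)) 2t<m)
        where
        t<s : t < s
        t<s = +-cancelˡ-< s t s (subst₂ _<_ (sym s+t≡m) (2*n≡n+n s) m<2s)
        2t<m : 2 * t < m
        2t<m = subst₂ _<_ (sym (2*n≡n+n t)) s+t≡m (+-monoˡ-< t t<s)

    pred-m⇒g₀ : s ≡ m ∸ 1 → g₁ ≐[ q ] g₀ r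
    pred-m⇒g₀ refl a ia with IsUnit⇒Unit ia
    ... | ua with region (proj₂ ua)
    ... | low a<m = trans (InT-low T₁ ua a<m) (sym (g₀-low a<m))
    ... | high 2m<a = trans (InT-high T₁ ua 2m<a) (sym (g₀-high 2m<a))
    ... | mid m<a a<2m with θpred-mid ua m<a a<2m
    ...   | inj₁ (a%3≡1 , 2m<θ) = trans (mid-complement ua m<a a<2m)
            (trans (cong not (trans (twist-at ua) (InT-high T₁ (θ-Unit us ua) 2m<θ)))
              (sym (g₀-mid m<a a<2m a%3≡1)))
    ...   | inj₂ (a%3≡2 , θ<m) = trans (mid-complement ua m<a a<2m)
            (trans (cong not (trans (twist-at ua) (InT-low T₁ (θ-Unit us ua) θ<m)))
              (sym (g₀-mid m<a a<2m a%3≡2)))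

    θ+m≡s⇒θ<m : ∀ {a} → θ s a + m ≡ s → s < 2 * m → θ s a < m
    θ+m≡s⇒θ<m {a} eq s<2m = +-cancelʳ-< m (θ s a) m (subst₂ _<_ (sym eq) (2*n≡n+n m) s<2m)

    mid⇒g₁[1+m]≡true : m < s → s < 2 * m → g₁ (1 + m) ≡ true
    mid⇒g₁[1+m]≡true m<s s<2m with residue₃ (proj₂ us)
    ... | 1+3* i = ⊥-elim (false≢true (trans (sym (InT-low T₁ (θ-Unit us unit-1+2m) θ<m))
                     (trans (sym (twist-at unit-1+2m)) (InT-high T₂ unit-1+2m (n<1+n (2 * m))))))
      where
      expand : ∀ i m → (1 + i * 3) * (1 + 2 * m) + m ≡ (1 + i * 3) + (1 + 2 * i) * (3 * m)
      expand = solve-∀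
      θ<m : θ s (1 + 2 * m) < m
      θ<m = θ+m≡s⇒θ<m {1 + 2 * m} (x+a≡c+kn⇒x%n+a≡c (1 + 2 * i) q (expand i m) (<⇒≤ m<s)
              (<-≤-trans (proj₁ us) (m≤n+m q m))) s<2m
    ... | 2+3* i = trans (mid-complement unit-1+m (n<1+n m) (c<m⇒c+m<2m 1<m))
                     (cong not (trans (twist-at unit-1+m) (InT-low T₁ (θ-Unit us unit-1+m) θ<m)))
      where
      expand : ∀ i m → (2 + i * 3) * (1 + m) + m ≡ (2 + i * 3) + (1 + i) * (3 * m)
      expand = solve-∀
      θ<m : θ s (1 + m) < m
      θ<m = θ+m≡s⇒θ<m {1 + m} (x+a≡c+kn⇒x%n+a≡c (1 + i) q (expand i m) (<⇒≤ m<s)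
              (<-≤-trans (proj₁ us) (m≤n+m q m))) s<2m

  twist-inverse : ∀ {g₁ g₂ s s'} → Unit s' → (s * s') % q ≡ 1 →
    g₂ ≐[ q ] (g₁ ∘θ[ r ] s) → g₁ ≐[ q ] (g₂ ∘θ[ r ] s')
  twist-inverse {g₁} {s = s} {s'} us' ss'≡1 twist a ia =
    trans (cong g₁ (sym (inverse-cancel {s} {s'} {a} q ss'≡1 (proj₁ ia))))
      (sym (twist _ (Unit⇒IsUnit (θ-Unit us' (IsUnit⇒Unit ia)))))

  Classification : ℕ → Fun → Set
  Classification s g₁ =
    (s ≡ m ∸ 1 × g₁ ≐[ q ] g₀ r) ⊎ (s ≡ 2 * m ∸ 1 × g₁ ≐[ q ] (g₀ r ∘θ[ r ] (m ∸ 1)))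

  module _ {g₁ g₂ s} (T₁ : InT r g₁) (T₂ : InT r g₂) (split : Splitting g₁ g₂) (us : Unit s)
           (twist : g₂ ≐[ q ] (g₁ ∘θ[ r ] s)) where

    private module F = Twisted T₁ T₂ split us twist

    classify-by-inverse : ∀ {s'} → Unit s' → (s * s') % q ≡ 1 → m < s → s < 2 * m →
      Region s' → Classification s g₁
    classify-by-inverse {s'} us' ss'≡1 m<s s<2m = classify
      where
      twist' : g₁ ≐[ q ] (g₂ ∘θ[ r ] s')
      twist' = twist-inverse {g₁} {g₂} {s} {s'} us' ss'≡1 twist
      module B = Twisted T₂ T₁ (splitting-sym {g₁} {g₂} split) us' twist'
      classify : Region s' → Classification s g₁
      classify (low s'<m) = inj₂ (s≡2m-1 , g₁≐)
        where
        s'≡pred-m : s' ≡ m ∸ 1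
        s'≡pred-m = B.low⇒pred-m s'<m
        s≡2m-1 : s ≡ 2 * m ∸ 1
        s≡2m-1 = inverse-unique q ss'≡1
          (subst (λ x → (x * (2 * m ∸ 1)) % q ≡ 1) (sym s'≡pred-m) θpred-inverse) (proj₁ us) (proj₁ unit-2m-1)
        g₁≐ : g₁ ≐[ q ] (g₀ r ∘θ[ r ] (m ∸ 1))
        g₁≐ a ia = trans (twist' a ia)
          (trans (B.pred-m⇒g₀ s'≡pred-m _ (Unit⇒IsUnit (θ-Unit us' (IsUnit⇒Unit ia))))
            (cong (λ x → g₀ r ((x * a) % q)) s'≡pred-m))
      classify (mid m<s' s'<2m) = ⊥-elim (not-¬ refl (begin
        g₁ (1 + m)        ≡⟨ F.mid-complement unit-1+m (n<1+n m) (c<m⇒c+m<2m 1<m) ⟩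
        not (g₂ (1 + m))  ≡⟨ cong not (B.mid⇒g₁[1+m]≡true m<s' s'<2m) ⟩
        false             ≡⟨ cong not (F.mid⇒g₁[1+m]≡true m<s s<2m) ⟨
        not (g₁ (1 + m))  ∎))
        where open ≡-Reasoning
      classify (high 2m<s') = ⊥-elim (B.not-high 2m<s')

    twisted-classification : Classification s g₁
    twisted-classification with region (proj₂ us)
    ... | low s<m = inj₁ (F.low⇒pred-m s<m , F.pred-m⇒g₀ (F.low⇒pred-m s<m))
    ... | high 2m<s = ⊥-elim (F.not-high 2m<s)
    ... | mid m<s s<2m =
      let s' , us' , ss'≡1 = unit-inverse us in classify-by-inverse us' ss'≡1 m<s s<2m (region (proj₂ us'))

  classification⇒twisted : ∀ {g₁ g₂ s} → Splitting g₁ g₂ → Classification s g₁ → g₂ ≐[ q ] (g₁ ∘θ[ r ] s)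
  classification⇒twisted {g₁} split (inj₁ (refl , g₁≐g₀)) a ia =
    trans (partner-of-g₀ {g₁} split g₁≐g₀ a ia)
      (sym (g₁≐g₀ _ (Unit⇒IsUnit (θ-Unit unit-m-1 (IsUnit⇒Unit ia)))))
  classification⇒twisted {g₁} split (inj₂ (refl , g₁≐)) a ia =
    trans (partner-of-g₀θ {g₁} split g₁≐ a ia)
      (sym (trans (g₁≐ _ (Unit⇒IsUnit (θ-Unit unit-2m-1 (IsUnit⇒Unit ia))))
        (cong (g₀ r) (inverse-cancel {m ∸ 1} {2 * m ∸ 1} q θpred-inverse (proj₁ ia)))))

lemma5p17 : (r : ℕ) → 3 ≤ r → (g₁ g₂ : Fun) → InT r g₁ → InT r g₂ →
    (∀ a → IsUnit (Q r) a → h r a ≡ b2n (g₁ a) + b2n (g₂ a)) →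
    ((s : ℕ) → IsUnit (Q r) s →
      (g₂ ≐[ Q r ] (g₁ ∘θ[ r ] s)) ⇔
        ((s ≡ Q r / 3 ∸ 1 × g₁ ≐[ Q r ] g₀ r)
          ⊎ (s ≡ 2 * (Q r / 3) ∸ 1 × g₁ ≐[ Q r ] (g₀ r ∘θ[ r ] (Q r / 3 ∸ 1)))))
    × (¬ (g₁ ≐[ Q r ] g₀ r) → ¬ (g₂ ≐[ Q r ] g₀ r) →
      (s : ℕ) → IsUnit (Q r) s → ¬ (g₂ ≐[ Q r ] (g₁ ∘θ[ r ] s)))
lemma5p17 (suc (suc (suc k))) (s≤s (s≤s (s≤s z≤n))) g₁ g₂ T₁ T₂ split rewrite Modulus.q/3≡m k =
  (λ s is → mk⇔ (classify s is) (classification⇒twisted {g₁} split)) ,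
  λ g₁≢g₀ g₂≢g₀ s is twist →
    [ g₁≢g₀ ∘ proj₂ , g₂≢g₀ ∘ partner-of-g₀θ {g₁} split ∘ proj₂ ]′ (classify s is twist)
  where
  open Modulus k
  classify : ∀ s → IsUnit q s → g₂ ≐[ q ] (g₁ ∘θ[ r ] s) → Classification s g₁
  classify s is = twisted-classification T₁ T₂ split (IsUnit⇒Unit is)
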